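{- Let $k$ be a positive integer, let $\mathcal{J}$ be a connected incidence graph with red vertices $R(\mathcal{J})=\{v_1,\dots,v_m\}$, $m\ge1$, and let $(T,\Gamma)$ be a strict elimination forest of $\mathcal{J}$ of height at most $k$ such that $T$ is a tree with root $\omega$. For every node $n\in V(T)$ of level $d$, with $t_1<_T t_2<_T\dots<_T t_d$ the nodes of $P(n)$ (so $t_1=\omega$, $t_d=n$), there exists $L_n=(\mathcal{I},r,b,g)\in\mathsf{GLI}_k^{k-d}$ such that (A) $\mathrm{dom}(b)=\{1,\dots,d\}$ and $\mathrm{dom}(r)=\mathrm{labels}(P(n))$; (B) $g(i)=\min\{j\in\{1,\dots,d\}: v_i\in\hat\Gamma(t_j)\}$ for every $i\in\mathrm{dom}(g)$; (C) there is an isomorphism $(\pi_R,\pi_B)$ from $\mathcal{I}$ to $\mathcal{J}[\dot T_n]$ with $\pi_R(r(i))=v_i$ for all $i\in\mathrm{dom}(r)$ and $\pi_B(b(j))=\Gamma(t_j)$ for all $j\in\mathrm{dom}(b)$.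
   Context: An incidence graph is $\mathcal{I}=(R(\mathcal{I}),B(\mathcal{I}),E(\mathcal{I}))$ with disjoint finite sets of red and blue vertices and $E(\mathcal{I})\subseteq B(\mathcal{I})\times R(\mathcal{I})$, every red vertex having a blue neighbour; $\beta(e)$ is the set of red neighbours of blue $e$. An isomorphism is a pair of bijections on red and on blue vertices preserving and reflecting edges. Trees: $\le_T$ is the tree order (root minimal); $P(s)$ is the node set of the path from $s$ to the root; $\mathrm{lcv}(s,t)$ the $\le_T$-maximum of $P(s)\cap P(t)$; $\mathrm{level}(s)=|P(s)|$; height = maximal level. A strict elimination forest of $\mathcal{J}$ is $(T,\Gamma)$ with $T$ a rooted forest and $\Gamma\colon V(T)\to B(\mathcal{J})$ bijective such that, with $\hat\Gamma(t)=\beta(\Gamma(t))$, whenever $\hat\Gamma(s)\cap\hat\Gamma(t)\neq\emptyset$, $\mathrm{lcv}(s,t)$ is defined and $\hat\Gamma(s)\cap\hat\Gamma(t)\subseteq\bigcup_{p\in P(\mathrm{lcv}(s,t))}\hat\Gamma(p)$. For a node $n$, $\mathrm{labels}(n)=\{i\in\{1,\dots,m\}: v_i\in\hat\Gamma(n)\}$ and $\mathrm{labels}(N)=\bigcup_{n\in N}\mathrm{labels}(n)$. The subtree with stem $\dot T_n$ is the subtree induced by $P(n)\cup\{t: n\le_T t\}$, and $\mathcal{J}[\dot T_n]$ is the incidence graph with blue vertices $\Gamma(V(\dot T_n))$, red vertices $\bigcup_{t\in V(\dot T_n)}\hat\Gamma(t)$ and the edges of $\mathcal{J}$ between them. $k$-labeled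 incidence graphs: $L=(\mathcal{I},r,b,g)$ with $r$ a partial map from positive integers to $R(\mathcal{I})$ with finite domain, $b\colon\{1,\dots,k\}\rightharpoonup B(\mathcal{I})$, $g$ a partial map from positive integers to $\{1,\dots,k\}$ with $\mathrm{dom}(g)=\mathrm{dom}(r)$. Real guards: for all $i\in\mathrm{dom}(r)$, $g(i)\in\mathrm{dom}(b)$ and $(b(g(i)),r(i))\in E(\mathcal{I})$. Partial maps are compatible if they agree on their common domain. Operations: removing red labels $X_r\subseteq\mathrm{dom}(r)$ restricts $r,g$ to $\mathrm{dom}(r)\setminus X_r$; removing blue labels $X_b$ restricts $b$ to $\mathrm{dom}(b)\setminus X_b$; glueing $L_1\cdot L_2$ takes the disjoint union of skeletons and identifies (transitively) $r_1(j)$ with $r_2(j)$ for $j\in\mathrm{dom}(r_1)\cap\mathrm{dom}(r_2)$ and $b_1(j)$ with $b_2(j)$ for $j\in\mathrm{dom}(b_1)\cap\mathrm{dom}(b_2)$, with induced label maps on the union of domains and $g=g_1\cup g_2$ ($g_1$ taking precedence); a transition for $L$ is a partial map $f$ from positive integers to $\{1,\dots,k\}$ with $\emptyset\ne\mathrm{dom}(f)\subseteq\mathrm{dom}(g)$ such that every $i\in\mathrm{dom}(g)$ with $g(i)\in\mathrm{img}(f)$ is in $\mathrm{dom}(f)$; $M_f$ has red $v_i$ ($i\in\mathrm{dom}f$), blue $e_j$ ($j\in\mathrm{img}f$), edges $(e_{f(i)},v_i)$, $r(i)=v_i$, $b(j)=e_j$, $g=f$; and $L[f]=M_f\cdot L'$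 where $L'$ is $L$ with blue labels $\mathrm{img}(g)\cap\mathrm{img}(f)\cap\mathrm{dom}(b)$ removed. Classes $\mathsf{GLI}_k^i$ are the smallest sets with: every $L$ with real guards in which every red and blue vertex carries a label lies in $\mathsf{GLI}_k^0$; $\mathsf{GLI}_k^i\subseteq\mathsf{GLI}_k^{i+1}$; glueing $L_1\in\mathsf{GLI}_k^{i_1}$, $L_2\in\mathsf{GLI}_k^{i_2}$ with compatible guard functions gives an element of $\mathsf{GLI}_k^{\max(i_1,i_2)}$; for $L\in\mathsf{GLI}_k^i$ and a transition $f$, $L[f]\in\mathsf{GLI}_k^{i+|\mathrm{img}(f)\cap\mathrm{dom}(b)\cap\mathrm{img}(g)|}$; removing any red labels keeps $L$ in $\mathsf{GLI}_k^i$; removing blue labels $X_b\subseteq\mathrm{dom}(b)\setminus\mathrm{img}(g)$ gives an element of $\mathsf{GLI}_k^{i+|X_b|}$. -}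

module Defs where

open import Data.Nat using (ℕ; zero; suc; _+_; _∸_; _≤_; _⊔_)
open import Data.Fin using (Fin; toℕ)
open import Data.Bool using (Bool; true; false)
open import Data.Maybe using (Maybe; just; nothing; is-just; _<∣>_)
import Data.Maybe as Maybe
open import Data.List using (List; []; _∷_; _++_; length)
open import Data.List.Membership.Propositional using (_∈_)
open import Data.List.Relation.Unary.Unique.Propositional using (Unique)
open import Data.Product using (Σ; ∃; _×_; _,_)
open import Data.Sum using (_⊎_; inj₁; inj₂)
open import Relation.Nullary using (¬_)
open import Relation.Binary.PropositionalEquality using (_≡_)
open import Relation.Binary.Construct.Closure.Equivalence using (EqClosure)
open import Relation.Binary.Construct.Closure.ReflexiveTransitive using (Star)
open import Induction.WellFounded using (WellFounded)
open import Function.Definitions using (Injective; Bijective)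
open import Function.Bundles using (_⇔_)

-- Incidence graphs.  Red vertices are Fin nR, blue vertices Fin nB,
-- E e v ≡ true means (e , v) ∈ E.

record IG : Set where
  field
    nR nB : ℕ
    E     : Fin nB → Fin nR → Bool
    hasNb : ∀ v → ∃ λ e → E e v ≡ true

data Adj (J : IG) : Fin (IG.nR J) ⊎ Fin (IG.nB J) → Fin (IG.nR J) ⊎ Fin (IG.nB J) → Set where
  rb : ∀ {v e} → IG.E J e v ≡ true → Adj J (inj₁ v) (inj₂ e)
  br : ∀ {v e} → IG.E J e v ≡ true → Adj J (inj₂ e) (inj₁ v)

Connected : IG → Set
Connected J = ∀ x y → Star (Adj J) x y

-- k-labeled incidence graphs.  Partial maps are ℕ → Maybe _ ;
-- positive integers are the naturals ≥ 1 (label 0 is never used).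

record LIG (k : ℕ) : Set where
  field
    nR nB : ℕ
    E     : Fin nB → Fin nR → Bool
    hasNb : ∀ v → ∃ λ e → E e v ≡ true
    r     : ℕ → Maybe (Fin nR)
    b     : ℕ → Maybe (Fin nB)
    g     : ℕ → Maybe ℕ
    r-pos  : r 0 ≡ nothing
    r-fin  : ∃ λ N → ∀ i → N ≤ i → r i ≡ nothing
    b-dom  : ∀ j e → b j ≡ just e → 1 ≤ j × j ≤ k
    g-dom  : ∀ i → is-just (g i) ≡ is-just (r i)
    g-rng  : ∀ i j → g i ≡ just j → 1 ≤ j × j ≤ k

open LIG

RealGuards : ∀ {k} → LIG k → Set
RealGuards L = ∀ i x j → r L i ≡ just x → g L i ≡ just j →
  Σ (Fin (nB L)) λ e → b L j ≡ just e × E L e x ≡ true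

AllLabeled : ∀ {k} → LIG k → Set
AllLabeled L = (∀ v → ∃ λ i → r L i ≡ just v) × (∀ e → ∃ λ j → b L j ≡ just e)

Compatible : (ℕ → Maybe ℕ) → (ℕ → Maybe ℕ) → Set
Compatible g₁ g₂ = ∀ i j₁ j₂ → g₁ i ≡ just j₁ → g₂ i ≡ just j₂ → j₁ ≡ j₂

record GraphIso {k} (L L' : LIG k) : Set where
  field
    φR  : Fin (nR L) → Fin (nR L')
    φR⁻ : Fin (nR L') → Fin (nR L)
    φB  : Fin (nB L) → Fin (nB L')
    φB⁻ : Fin (nB L') → Fin (nB L)
    invR₁ : ∀ v → φR⁻ (φR v) ≡ v
    invR₂ : ∀ v → φR (φR⁻ v) ≡ v
    invB₁ : ∀ e → φB⁻ (φB e) ≡ e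
    invB₂ : ∀ e → φB (φB⁻ e) ≡ e
    edges : ∀ e v → E L' (φB e) (φR v) ≡ E L e v

-- L' is (up to renaming of vertices) L with the red labels X removed
RemoveRed : ∀ {k} → List ℕ → LIG k → LIG k → Set
RemoveRed X L L' = Σ (GraphIso L L') λ φ →
  (∀ i → (i ∈ X → r L' i ≡ nothing × g L' i ≡ nothing) ×
         (¬ i ∈ X → r L' i ≡ Maybe.map (GraphIso.φR φ) (r L i) × g L' i ≡ g L i)) ×
  (∀ j → b L' j ≡ Maybe.map (GraphIso.φB φ) (b L j))

-- L' is (up to renaming of vertices) L with the blue labels X removed
RemoveBlue : ∀ {k} → List ℕ → LIG k → LIG k → Set
RemoveBlue X L L' = Σ (GraphIso L L') λ φ →
  (∀ i → r L' i ≡ Maybe.map (GraphIso.φR φ) (r L i) × g L' i ≡ g L i) ×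
  (∀ j → (j ∈ X → b L' j ≡ nothing) ×
         (¬ j ∈ X → b L' j ≡ Maybe.map (GraphIso.φB φ) (b L j)))

data RedId {k} (L₁ L₂ : LIG k) : Fin (nR L₁) ⊎ Fin (nR L₂) → Fin (nR L₁) ⊎ Fin (nR L₂) → Set where
  ident : ∀ j x y → r L₁ j ≡ just x → r L₂ j ≡ just y → RedId L₁ L₂ (inj₁ x) (inj₂ y)

data BlueId {k} (L₁ L₂ : LIG k) : Fin (nB L₁) ⊎ Fin (nB L₂) → Fin (nB L₁) ⊎ Fin (nB L₂) → Set where
  ident : ∀ j x y → b L₁ j ≡ just x → b L₂ j ≡ just y → BlueId L₁ L₂ (inj₁ x) (inj₂ y)

[_,_] : ∀ {A B C : Set} → (A → C) → (B → C) → A ⊎ B → C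
[ f , h ] (inj₁ a) = f a
[ f , h ] (inj₂ a) = h a

-- L is (up to isomorphism) the glueing L₁ · L₂ : the disjoint union of
-- the skeletons modulo the equivalence generated by the identifications,
-- with ρ, σ the quotient maps on red and blue vertices.
record IsGlue {k} (L₁ L₂ L : LIG k) : Set where
  field
    ρ₁ : Fin (nR L₁) → Fin (nR L)
    ρ₂ : Fin (nR L₂) → Fin (nR L)
    σ₁ : Fin (nB L₁) → Fin (nB L)
    σ₂ : Fin (nB L₂) → Fin (nB L)
    ρ-surj : ∀ v → ∃ λ u → [ ρ₁ , ρ₂ ] u ≡ v
    σ-surj : ∀ e → ∃ λ u → [ σ₁ , σ₂ ] u ≡ e
    ρ-ker : ∀ u w → ([ ρ₁ , ρ₂ ] u ≡ [ ρ₁ , ρ₂ ] w) ⇔ EqClosure (RedId L₁ L₂) u w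
    σ-ker : ∀ u w → ([ σ₁ , σ₂ ] u ≡ [ σ₁ , σ₂ ] w) ⇔ EqClosure (BlueId L₁ L₂) u w
    edges : ∀ e v → (E L e v ≡ true) ⇔
      ((Σ (Fin (nB L₁)) λ e₁ → Σ (Fin (nR L₁)) λ v₁ → σ₁ e₁ ≡ e × ρ₁ v₁ ≡ v × E L₁ e₁ v₁ ≡ true) ⊎
       (Σ (Fin (nB L₂)) λ e₂ → Σ (Fin (nR L₂)) λ v₂ → σ₂ e₂ ≡ e × ρ₂ v₂ ≡ v × E L₂ e₂ v₂ ≡ true))
    r-glue : ∀ i → r L i ≡ (Maybe.map ρ₁ (r L₁ i) <∣> Maybe.map ρ₂ (r L₂ i))
    b-glue : ∀ j → b L j ≡ (Maybe.map σ₁ (b L₁ j) <∣> Maybe.map σ₂ (b L₂ j))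
    g-glue : ∀ i → g L i ≡ (g L₁ i <∣> g L₂ i)

IsTransition : ∀ {k} → LIG k → (ℕ → Maybe ℕ) → Set
IsTransition {k} L f =
  (∃ λ i → is-just (f i) ≡ true) ×
  (∀ i → is-just (f i) ≡ true → is-just (g L i) ≡ true) ×
  (∀ i j → f i ≡ just j → 1 ≤ j × j ≤ k) ×
  (∀ i j → g L i ≡ just j → (∃ λ i' → f i' ≡ just j) → is-just (f i) ≡ true)

-- M is (up to isomorphism) the labeled graph M_f
record IsM {k} (f : ℕ → Maybe ℕ) (M : LIG k) : Set where
  field
    r-dom  : ∀ i → is-just (r M i) ≡ is-just (f i)
    r-inj  : ∀ i i' x → r M i ≡ just x → r M i' ≡ just x → i ≡ i'
    r-surj : ∀ v → ∃ λ i → r M i ≡ just v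
    b-dom  : ∀ j → (is-just (b M j) ≡ true) ⇔ (∃ λ i → f i ≡ just j)
    b-inj  : ∀ j j' e → b M j ≡ just e → b M j' ≡ just e → j ≡ j'
    b-surj : ∀ e → ∃ λ j → b M j ≡ just e
    edges  : ∀ i j x e → r M i ≡ just x → b M j ≡ just e → (E M e x ≡ true) ⇔ (f i ≡ just j)
    g-eq   : ∀ i → g M i ≡ f i

data GLI (k : ℕ) : ℕ → LIG k → Set where
  base : ∀ {L} → RealGuards L → AllLabeled L → GLI k 0 L
  up   : ∀ {i L} → GLI k i L → GLI k (suc i) L
  glue : ∀ {i₁ i₂ L₁ L₂ L} → GLI k i₁ L₁ → GLI k i₂ L₂ →
         Compatible (g L₁) (g L₂) → IsGlue L₁ L₂ L → GLI k (i₁ ⊔ i₂) L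
  trans : ∀ {i L} (f : ℕ → Maybe ℕ) (Y : List ℕ) {L' M L''} →
         GLI k i L → IsTransition L f →
         Unique Y →
         (∀ j → (j ∈ Y) ⇔ ((∃ λ i' → f i' ≡ just j) × is-just (b L j) ≡ true × (∃ λ i' → g L i' ≡ just j))) →
         RemoveBlue Y L L' → IsM f M → IsGlue M L' L'' →
         GLI k (i + length Y) L''
  remRed : ∀ {i L L'} (X : List ℕ) → GLI k i L →
         (∀ j → j ∈ X → is-just (r L j) ≡ true) →
         RemoveRed X L L' → GLI k i L'
  remBlue : ∀ {i L L'} (X : List ℕ) → GLI k i L → Unique X →
         (∀ j → j ∈ X → is-just (b L j) ≡ true × ¬ (∃ λ i' → g L i' ≡ just j)) →
         RemoveBlue X L L' → GLI k (i + length X) L'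

record Forest : Set where
  field
    nT     : ℕ
    parent : Fin nT → Maybe (Fin nT)
    acyclic : WellFounded (λ p t → parent t ≡ just p)

Node : Forest → Set
Node F = Fin (Forest.nT F)

-- s ≤T t  iff  s ∈ P(t)
data _⊢_≤T_ (F : Forest) : Node F → Node F → Set where
  here  : ∀ {t} → F ⊢ t ≤T t
  there : ∀ {s t p} → Forest.parent F t ≡ just p → F ⊢ s ≤T p → F ⊢ s ≤T t

-- RootPath F n ts : ts = t₁ ∷ … ∷ t_d lists the nodes of P(n) from the root to n
data RootPath (F : Forest) : Node F → List (Node F) → Set where
  root : ∀ {n} → Forest.parent F n ≡ nothing → RootPath F n (n ∷ [])
  step : ∀ {n p ts} → Forest.parent F n ≡ just p → RootPath F p ts → RootPath F n (ts ++ n ∷ [])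

-- 1-based list lookup: nth ts j = t_j
nth : ∀ {A : Set} → List A → ℕ → Maybe A
nth [] _ = nothing
nth (x ∷ xs) zero = nothing
nth (x ∷ xs) (suc zero) = just x
nth (x ∷ xs) (suc (suc j)) = nth xs (suc j)

IsLcv : (F : Forest) → Node F → Node F → Node F → Set
IsLcv F s t l = F ⊢ l ≤T s × F ⊢ l ≤T t × (∀ l' → F ⊢ l' ≤T s → F ⊢ l' ≤T t → F ⊢ l' ≤T l)

_∈Γ̂[_,_,_]_ : (J : IG) → Fin (IG.nR J) → (F : Forest) → (Node F → Fin (IG.nB J)) → Node F → Set
(J ∈Γ̂[ v , F , Γ ] t) = IG.E J (Γ t) v ≡ true

StrictElimForest : (J : IG) (F : Forest) → (Node F → Fin (IG.nB J)) → Set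
StrictElimForest J F Γ =
  Bijective _≡_ _≡_ Γ ×
  (∀ s t v → J ∈Γ̂[ v , F , Γ ] s → J ∈Γ̂[ v , F , Γ ] t →
     Σ (Node F) λ l → IsLcv F s t l × Σ (Node F) λ p → F ⊢ p ≤T l × J ∈Γ̂[ v , F , Γ ] p)

HeightAtMost : Forest → ℕ → Set
HeightAtMost F k = ∀ n ts → RootPath F n ts → length ts ≤ k

IsTreeWithRoot : (F : Forest) → Node F → Set
IsTreeWithRoot F ω = Forest.parent F ω ≡ nothing × (∀ t → F ⊢ ω ≤T t)

-- node t belongs to the subtree with stem Ṫ_n
InStem : (F : Forest) → Node F → Node F → Set
InStem F n t = F ⊢ t ≤T n ⊎ F ⊢ n ≤T t

record IsoToStem {k} (J : IG) (F : Forest) (Γ : Node F → Fin (IG.nB J)) (n : Node F) (L : LIG k)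
                 (πR : Fin (nR L) → Fin (IG.nR J)) (πB : Fin (nB L) → Fin (IG.nB J)) : Set where
  field
    πR-inj : Injective _≡_ _≡_ πR
    πB-inj : Injective _≡_ _≡_ πB
    πR-into : ∀ v → Σ (Node F) λ t → InStem F n t × J ∈Γ̂[ πR v , F , Γ ] t
    πR-onto : ∀ x t → InStem F n t → J ∈Γ̂[ x , F , Γ ] t → ∃ λ v → πR v ≡ x
    πB-into : ∀ e → Σ (Node F) λ t → InStem F n t × πB e ≡ Γ t
    πB-onto : ∀ t → InStem F n t → ∃ λ e → πB e ≡ Γ t
    edges   : ∀ e v → E L e v ≡ IG.E J (πB e) (πR v)

-- i ∈ labels(P(n)), with P(n) listed as ts ; v_i is the red vertex x with toℕ x = i - 1
InLabels : (J : IG) (F : Forest) (Γ : Node F → Fin (IG.nB J)) → List (Node F) → ℕ → Set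
InLabels J F Γ ts i = Σ (Fin (IG.nR J)) λ x → suc (toℕ x) ≡ i × Σ (Node F) λ t → t ∈ ts × J ∈Γ̂[ x , F , Γ ] t

IsMinIndex : (J : IG) (F : Forest) (Γ : Node F → Fin (IG.nB J)) → List (Node F) → ℕ → ℕ → Set
IsMinIndex J F Γ ts i j = Σ (Fin (IG.nR J)) λ x → suc (toℕ x) ≡ i ×
  1 ≤ j × j ≤ length ts ×
  (Σ (Node F) λ t → nth ts j ≡ just t × J ∈Γ̂[ x , F , Γ ] t) ×
  (∀ j' t' → nth ts j' ≡ just t' → J ∈Γ̂[ x , F , Γ ] t' → j ≤ j')

module Submission where

-- L_n is the labelled graph induced by the subtree with stem Ṫ_n: blue label j on Γ(t_j), and
-- red label i on v_i for every i ∈ labels(P(n)), guarded by the first t_j incident to v_i.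
-- If the stem is just P(n) every vertex is labelled, so L_n ∈ GLI⁰.  Otherwise, for each child c
-- of n, removing from L_c the red labels first guarded by Γ(c) leaves the blue label d + 1 of Γ(c)
-- unused as a guard; removing it costs one level, taking L_c from GLI^(k-d-1) to GLI^(k-d).
-- Glueing these graphs one by one onto the graph of P(n) yields L_n: distinct child subtrees
-- share blue vertices only on P(n), and by strictness of the elimination forest they share a red
-- vertex only if it is incident to P(n), i.e. labelled, so glueing identifies exactly the
-- common vertices.

open import Defs hiding (trans)
open import Data.Nat using (ℕ; zero; suc; pred; _+_; _∸_; _⊔_; _≤_; _<_; z≤n; s≤s)
open import Data.Nat.Properties
  using (≤-trans; ≤-refl; <-irrefl; +-comm; ⊔-idem; m∸n≡0⇒m≤n; pred[m∸n]≡m∸[1+n])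
open import Data.Fin using (Fin; toℕ; zero; suc)
open import Data.Fin.Properties using (_≟_; any?)
open import Data.Bool using (true; false)
import Data.Bool.Properties as Bool
open import Data.Maybe using (Maybe; just; nothing; is-just; _>>=_; _<∣>_)
import Data.Maybe as Maybe
open import Data.Maybe.Properties
  using (just-injective; ≡-dec; map-id; map-∘; map-cong; map-<∣>; map-injective; <∣>-idem)
open import Data.List using (List; []; _∷_; _++_; _∷ʳ_; length; lookup; filter; allFin; map)
open import Data.List.Membership.Propositional using (_∈_; _∉_; find; lose)
open import Data.List.Membership.Propositional.Properties
  using (∈-lookup; ∈-filter⁺; ∈-filter⁻; ∈-allFin; ∈-map⁺; ∈-map⁻; ∈-++⁻; ∈-++⁺ˡ; ∈-++⁺ʳ)
open import Data.List.Relation.Unary.Any using (Any; here; there)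
import Data.List.Relation.Unary.Any as Any
open import Data.List.Relation.Unary.Any.Properties using (lookup-index)
import Data.List.Relation.Unary.All as All
open import Data.List.Relation.Unary.AllPairs using ([]; _∷_)
open import Data.List.Relation.Unary.Unique.Propositional using (Unique)
open import Data.List.Relation.Unary.Unique.Propositional.Properties using (filter⁺; allFin⁺)
open import Data.Product using (Σ; ∃; ∃-syntax; _×_; _,_; proj₁; proj₂)
open import Data.Sum using (_⊎_; inj₁; inj₂)
open import Data.Empty using (⊥-elim)
open import Level using (0ℓ)
open import Relation.Nullary using (¬_; Dec; yes; no)
open import Relation.Unary using (Pred; Decidable; _⊆_; _∪_)
open import Relation.Nullary.Decidable using (_×-dec_; _⊎-dec_)
open import Relation.Binary using (Rel)
open import Relation.Binary.PropositionalEquality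
  using (_≡_; _≢_; refl; sym; trans; cong; cong₂; subst; module ≡-Reasoning)
open import Relation.Binary.Construct.Closure.Equivalence using (EqClosure)
open import Relation.Binary.Construct.Closure.ReflexiveTransitive using (ε; _◅_)
open import Relation.Binary.Construct.Closure.Symmetric using (fwd; bwd)
open import Function.Base using (id; _∘_)
open import Function.Definitions using (Injective)
open import Function.Bundles using (_⇔_; mk⇔)
open import Induction.WellFounded using (Acc; acc)

is-just-map : ∀ {A B : Set} (f : A → B) m → is-just (Maybe.map f m) ≡ is-just m
is-just-map f nothing = refl
is-just-map f (just _) = refl

is-just≡false : ∀ {A : Set} {m : Maybe A} → is-just m ≡ false → m ≡ nothing
is-just≡false {m = nothing} _ = refl

is-just⇒just : ∀ {A : Set} (m : Maybe A) → is-just m ≡ true → ∃[ x ] m ≡ just x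
is-just⇒just (just x) _ = x , refl

nothing≢just : ∀ {A : Set} {x : A} → nothing ≢ just x
nothing≢just ()

>>=-just : ∀ {A B : Set} {f : A → Maybe B} (m : Maybe A) {y} →
           (m >>= f) ≡ just y → ∃[ x ] m ≡ just x × f x ≡ just y
>>=-just (just x) eq = x , refl , eq

>>=-nothing : ∀ {A B : Set} {f : A → Maybe B} {m : Maybe A} → m ≡ nothing → (m >>= f) ≡ nothing
>>=-nothing refl = refl

toFin? : ∀ {n} → ℕ → Maybe (Fin n)
toFin? {zero} _ = nothing
toFin? {suc n} zero = just zero
toFin? {suc n} (suc i) = Maybe.map suc (toFin? i)

toFin?-toℕ : ∀ {n} (x : Fin n) → toFin? (toℕ x) ≡ just x
toFin?-toℕ zero = refl
toFin?-toℕ (suc x) = cong (Maybe.map suc) (toFin?-toℕ x)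

toFin?-just : ∀ {n} i {x : Fin n} → toFin? i ≡ just x → toℕ x ≡ i
toFin?-just {suc n} zero refl = refl
toFin?-just {suc n} (suc i) eq with toFin? {n} i in e
toFin?-just {suc n} (suc i) refl | just y = cong suc (toFin?-just i e)

toFin?-≥ : ∀ {n} i → n ≤ i → toFin? {n} i ≡ nothing
toFin?-≥ {zero} i _ = refl
toFin?-≥ {suc n} (suc i) (s≤s n≤i) = cong (Maybe.map suc) (toFin?-≥ i n≤i)

module _ {A : Set} where

  nth-suc : ∀ {x} (xs : List A) {j t} → nth xs j ≡ just t → nth (x ∷ xs) (suc j) ≡ just t
  nth-suc (_ ∷ _) {suc _} eq = eq

  nth⇒∈ : ∀ (xs : List A) j {t} → nth xs j ≡ just t → t ∈ xs
  nth⇒∈ (x ∷ xs) (suc zero) refl = here refl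
  nth⇒∈ (x ∷ xs) (suc (suc j)) eq = there (nth⇒∈ xs (suc j) eq)

  nth-bounds : ∀ (xs : List A) j {t} → nth xs j ≡ just t → 1 ≤ j × j ≤ length xs
  nth-bounds (x ∷ xs) (suc zero) refl = s≤s z≤n , s≤s z≤n
  nth-bounds (x ∷ xs) (suc (suc j)) eq = s≤s z≤n , s≤s (proj₂ (nth-bounds xs (suc j) eq))

  ∈⇒nth : ∀ (xs : List A) {t} → t ∈ xs → ∃[ j ] nth xs j ≡ just t
  ∈⇒nth (x ∷ xs) (here refl) = 1 , refl
  ∈⇒nth (x ∷ xs) (there t∈xs) with ∈⇒nth xs t∈xs
  ... | j , eq = suc j , nth-suc xs eq

  nth-inRange : ∀ (xs : List A) j → 1 ≤ j → j ≤ length xs → ∃[ t ] nth xs j ≡ just t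
  nth-inRange (x ∷ xs) (suc zero) _ _ = x , refl
  nth-inRange (x ∷ xs) (suc (suc j)) _ (s≤s j<) = nth-inRange xs (suc j) (s≤s z≤n) j<

  is-just-nth : ∀ (xs : List A) j → (is-just (nth xs j) ≡ true) ⇔ (1 ≤ j × j ≤ length xs)
  is-just-nth xs j = mk⇔
    (λ isJust → let _ , nth≡ = is-just⇒just (nth xs j) isJust in nth-bounds xs j nth≡)
    (λ (1≤j , j≤len) → let _ , nth≡ = nth-inRange xs j 1≤j j≤len in cong is-just nth≡)

  nth-beyond : ∀ (xs : List A) j → length xs < j → nth xs j ≡ nothing
  nth-beyond [] j _ = refl
  nth-beyond (x ∷ xs) (suc (suc j)) (s≤s len<) = nth-beyond xs (suc j) len<

  nth-∷ʳ-last : ∀ (xs : List A) c → nth (xs ∷ʳ c) (suc (length xs)) ≡ just c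
  nth-∷ʳ-last [] c = refl
  nth-∷ʳ-last (x ∷ xs) c = nth-∷ʳ-last xs c

  nth-∷ʳ : ∀ (xs : List A) c j → j ≢ suc (length xs) → nth (xs ∷ʳ c) j ≡ nth xs j
  nth-∷ʳ [] c zero _ = refl
  nth-∷ʳ [] c (suc zero) j≢1 = ⊥-elim (j≢1 refl)
  nth-∷ʳ [] c (suc (suc j)) _ = refl
  nth-∷ʳ (x ∷ xs) c zero _ = refl
  nth-∷ʳ (x ∷ xs) c (suc zero) _ = refl
  nth-∷ʳ (x ∷ xs) c (suc (suc j)) j≢ = nth-∷ʳ xs c (suc j) (λ eq → j≢ (cong suc eq))

  length-∷ʳ : ∀ (xs : List A) c → length (xs ∷ʳ c) ≡ suc (length xs)
  length-∷ʳ [] c = refl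
  length-∷ʳ (x ∷ xs) c = cong suc (length-∷ʳ xs c)

  lookup-injective : ∀ {xs : List A} → Unique xs → Injective _≡_ _≡_ (lookup xs)
  lookup-injective (_ ∷ _) {zero} {zero} _ = refl
  lookup-injective (x∉ ∷ _) {zero} {suc j} eq = ⊥-elim (All.lookup x∉ (∈-lookup j) eq)
  lookup-injective (x∉ ∷ _) {suc i} {zero} eq = ⊥-elim (All.lookup x∉ (∈-lookup i) (sym eq))
  lookup-injective (_ ∷ xs!) {suc i} {suc j} eq = cong suc (lookup-injective xs! eq)

module _ {A : Set} {P : Pred A 0ℓ} (P? : Decidable P) where

  firstPosition : List A → Maybe ℕ
  firstPosition [] = nothing
  firstPosition (x ∷ xs) with P? x
  ... | yes _ = just 1
  ... | no _ = Maybe.map suc (firstPosition xs)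

  firstPosition-sound : ∀ xs {j} → firstPosition xs ≡ just j → ∃[ t ] nth xs j ≡ just t × P t
  firstPosition-sound (x ∷ xs) eq with P? x
  firstPosition-sound (x ∷ xs) refl | yes px = x , refl , px
  ... | no _ with firstPosition xs in e
  firstPosition-sound (x ∷ xs) refl | no _ | just j with firstPosition-sound xs e
  ... | t , nth≡ , pt = t , nth-suc xs nth≡ , pt

  firstPosition-least : ∀ xs {j j' t} → firstPosition xs ≡ just j → nth xs j' ≡ just t → P t → j ≤ j'
  firstPosition-least (x ∷ xs) eq nth≡ pt with P? x
  firstPosition-least (x ∷ xs) refl nth≡ pt | yes _ = proj₁ (nth-bounds (x ∷ xs) _ nth≡)
  ... | no ¬px with firstPosition xs in e
  firstPosition-least (x ∷ xs) {j' = suc zero} refl refl pt | no ¬px | just _ = ⊥-elim (¬px pt)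
  firstPosition-least (x ∷ xs) {j' = suc (suc j')} refl nth≡ pt | no _ | just _ =
    s≤s (firstPosition-least xs e nth≡ pt)

  firstPosition-complete : ∀ xs {t} → t ∈ xs → P t → ∃[ j ] firstPosition xs ≡ just j
  firstPosition-complete (x ∷ xs) t∈ pt with P? x
  ... | yes _ = 1 , refl
  firstPosition-complete (x ∷ xs) (here refl) pt | no ¬px = ⊥-elim (¬px pt)
  firstPosition-complete (x ∷ xs) (there t∈) pt | no _ with firstPosition-complete xs t∈ pt
  ... | j , eq = suc j , cong (Maybe.map suc) eq

  firstPosition-++ : ∀ xs ys {j} → firstPosition xs ≡ just j → firstPosition (xs ++ ys) ≡ just j
  firstPosition-++ (x ∷ xs) ys eq with P? x
  ... | yes _ = eq
  ... | no _ with firstPosition xs in e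
  firstPosition-++ (x ∷ xs) ys refl | no _ | just j = cong (Maybe.map suc) (firstPosition-++ xs ys e)

module Enumeration {n : ℕ} {P : Pred (Fin n) 0ℓ} (P? : Decidable P) where

  elements : List (Fin n)
  elements = filter P? (allFin n)

  size : ℕ
  size = length elements

  enc : Fin size → Fin n
  enc = lookup elements

  enc-injective : Injective _≡_ _≡_ enc
  enc-injective = lookup-injective (filter⁺ P? (allFin⁺ n))

  enc-sat : ∀ z → P (enc z)
  enc-sat z = proj₂ (∈-filter⁻ P? {xs = allFin n} (∈-lookup z))

  index : ∀ x → P x → Fin size
  index x px = Any.index (∈-filter⁺ P? (∈-allFin x) px)

  enc-index : ∀ x px → enc (index x px) ≡ x
  enc-index x px = sym (lookup-index (∈-filter⁺ P? (∈-allFin x) px))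

  index? : Fin n → Maybe (Fin size)
  index? x with P? x
  ... | yes px = just (index x px)
  ... | no _ = nothing

  index?-enc : ∀ z → index? (enc z) ≡ just z
  index?-enc z with P? (enc z)
  ... | yes pz = cong just (enc-injective (enc-index (enc z) pz))
  ... | no ¬pz = ⊥-elim (¬pz (enc-sat z))

  bind-index?-just : ∀ (m : Maybe (Fin n)) {z} → (m >>= index?) ≡ just z → m ≡ just (enc z)
  bind-index?-just (just x) eq with P? x
  bind-index?-just (just x) refl | yes px = cong just (sym (enc-index x px))

  bind-index?-enc : ∀ {m : Maybe (Fin n)} {z} → m ≡ just (enc z) → (m >>= index?) ≡ just z
  bind-index?-enc {z = z} refl = index?-enc z

  map-enc-bind-index? : ∀ (m : Maybe (Fin n)) → (∀ {x} → m ≡ just x → P x) →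
                        Maybe.map enc (m >>= index?) ≡ m
  map-enc-bind-index? nothing _ = refl
  map-enc-bind-index? (just x) sat with P? x
  ... | yes px = cong just (enc-index x px)
  ... | no ¬px = ⊥-elim (¬px (sat refl))

module _ {A B C : Set} {f : A → C} {h : B → C} (f-inj : Injective _≡_ _≡_ f) (h-inj : Injective _≡_ _≡_ h)
         {R : Rel (A ⊎ B) 0ℓ} (R⇒≡ : ∀ {u w} → R u w → [ f , h ] u ≡ [ f , h ] w)
         (≡⇒R : ∀ {x y} → f x ≡ h y → R (inj₁ x) (inj₂ y)) where

  private
    EqClosure⇒≡ : ∀ {u w} → EqClosure R u w → [ f , h ] u ≡ [ f , h ] w
    EqClosure⇒≡ ε = refl
    EqClosure⇒≡ (fwd r ◅ rs) = trans (R⇒≡ r) (EqClosure⇒≡ rs)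
    EqClosure⇒≡ (bwd r ◅ rs) = trans (sym (R⇒≡ r)) (EqClosure⇒≡ rs)

    ≡⇒EqClosure : ∀ u w → [ f , h ] u ≡ [ f , h ] w → EqClosure R u w
    ≡⇒EqClosure (inj₁ x) (inj₁ y) eq with f-inj eq
    ... | refl = ε
    ≡⇒EqClosure (inj₂ x) (inj₂ y) eq with h-inj eq
    ... | refl = ε
    ≡⇒EqClosure (inj₁ x) (inj₂ y) eq = fwd (≡⇒R eq) ◅ ε
    ≡⇒EqClosure (inj₂ x) (inj₁ y) eq = bwd (≡⇒R (sym eq)) ◅ ε

  [,]-≡⇔EqClosure : ∀ u w → ([ f , h ] u ≡ [ f , h ] w) ⇔ EqClosure R u w
  [,]-≡⇔EqClosure u w = mk⇔ (≡⇒EqClosure u w) EqClosure⇒≡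

-- Rooted forests

module ForestProperties (F : Forest) where
  open Forest F

  infix 4 _≤T_
  _≤T_ : Node F → Node F → Set
  s ≤T t = F ⊢ s ≤T t

  ≤T-trans : ∀ {s t u} → s ≤T t → t ≤T u → s ≤T u
  ≤T-trans s≤t here = s≤t
  ≤T-trans s≤t (there e t≤p) = there e (≤T-trans s≤t t≤p)

  parent-≤T : ∀ {c n} → parent c ≡ just n → n ≤T c
  parent-≤T e = there e here

  parent-unique : ∀ {t p q} → parent t ≡ just p → parent t ≡ just q → p ≡ q
  parent-unique e e' = just-injective (trans (sym e) e')

  not-≤T-parent : ∀ {c p} → parent c ≡ just p → ¬ (c ≤T p)
  not-≤T-parent {c} = go c (acyclic c)
    where
      go : ∀ c → Acc (λ p t → parent t ≡ just p) c → ∀ {p} → parent c ≡ just p → ¬ (c ≤T p)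
      go c (acc rs) e here = go c (rs e) e here
      go c (acc rs) e (there e' c≤q) = go _ (rs e) e' (≤T-trans (parent-≤T e) c≤q)

  below-child : ∀ {c n t} → parent c ≡ just n → t ≤T c → t ≡ c ⊎ t ≤T n
  below-child pc here = inj₁ refl
  below-child {t = t} pc (there e t≤p) = inj₂ (subst (t ≤T_) (parent-unique e pc) t≤p)

  ≤T-comparable : ∀ {a b t} → a ≤T t → b ≤T t → a ≤T b ⊎ b ≤T a
  ≤T-comparable here b≤t = inj₂ b≤t
  ≤T-comparable (there e a≤p) here = inj₁ (there e a≤p)
  ≤T-comparable {b = b} (there e a≤p) (there e' b≤p) =
    ≤T-comparable a≤p (subst (b ≤T_) (parent-unique e' e) b≤p)

  ≤T-step : ∀ {n l} → n ≤T l → n ≡ l ⊎ ∃[ c ] parent c ≡ just n × c ≤T l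
  ≤T-step here = inj₁ refl
  ≤T-step (there e n≤p) with ≤T-step n≤p
  ... | inj₁ refl = inj₂ (_ , e , here)
  ... | inj₂ (c , pc , c≤p) = inj₂ (c , pc , there e c≤p)

  children-disjoint : ∀ {c c' n x} → parent c ≡ just n → parent c' ≡ just n → c ≤T x → c' ≤T x → c ≡ c'
  children-disjoint pc pc' c≤x c'≤x with ≤T-comparable c≤x c'≤x
  ... | inj₁ c≤c' = sibling pc pc' c≤c'
    where
      sibling : ∀ {c c' n} → parent c ≡ just n → parent c' ≡ just n → c ≤T c' → c ≡ c'
      sibling pc pc' c≤c' with below-child pc' c≤c'
      ... | inj₁ c≡c' = c≡c'
      ... | inj₂ c≤n = ⊥-elim (not-≤T-parent pc c≤n)
  ... | inj₂ c'≤c with below-child pc c'≤c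
  ...   | inj₁ c'≡c = sym c'≡c
  ...   | inj₂ c'≤n = ⊥-elim (not-≤T-parent pc' c'≤n)

  _≤T?_ : ∀ s t → Dec (s ≤T t)
  s ≤T? t = go t (acyclic t)
    where
      go : ∀ t → Acc (λ p t → parent t ≡ just p) t → Dec (s ≤T t)
      go t (acc rs) with s ≟ t
      ... | yes refl = yes here
      ... | no s≢t with parent t in e
      ...   | nothing = no λ { here → s≢t refl ; (there e' _) → nothing≢just (trans (sym e) e') }
      ...   | just p with go p (rs refl)
      ...     | yes s≤p = yes (there e s≤p)
      ...     | no s≰p = no λ
                    { here → s≢t refl
                    ; (there e' s≤q) → s≰p (subst (s ≤T_) (parent-unique e' e) s≤q) }

  path-≤T : ∀ {n ts t} → RootPath F n ts → t ∈ ts → t ≤T n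
  path-≤T (root _) (here refl) = here
  path-≤T (step {ts = ts} e rp) t∈ with ∈-++⁻ ts t∈
  ... | inj₁ t∈ts = there e (path-≤T rp t∈ts)
  ... | inj₂ (here refl) = here

  ≤T-path : ∀ {n ts t} → RootPath F n ts → t ≤T n → t ∈ ts
  ≤T-path (root _) here = here refl
  ≤T-path (root e) (there e' _) = ⊥-elim (nothing≢just (trans (sym e) e'))
  ≤T-path (step {ts = ts} _ _) here = ∈-++⁺ʳ ts (here refl)
  ≤T-path {t = t} (step e rp) (there e' t≤p) = ∈-++⁺ˡ (≤T-path rp (subst (t ≤T_) (parent-unique e' e) t≤p))

-- Labelled incidence graphs induced by sets of forest nodes

module Construction (k : ℕ) (J : IG) (F : Forest) (Γ : Node F → Fin (IG.nB J)) where

  Red : Set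
  Red = Fin (IG.nR J)

  _∈̂_ : Red → Node F → Set
  x ∈̂ t = J ∈Γ̂[ x , F , Γ ] t

  _∈̂?_ : ∀ x t → Dec (x ∈̂ t)
  x ∈̂? t = IG.E J (Γ t) x Bool.≟ true

  label : Red → ℕ
  label x = suc (toℕ x)

  vertex : ℕ → Maybe Red
  vertex zero = nothing
  vertex (suc i) = toFin? i

  vertex-label : ∀ x → vertex (label x) ≡ just x
  vertex-label = toFin?-toℕ

  vertex-just : ∀ i {x} → vertex i ≡ just x → label x ≡ i
  vertex-just (suc i) eq = cong suc (toFin?-just i eq)

  vertex-beyond : ∀ i → suc (IG.nR J) ≤ i → vertex i ≡ nothing
  vertex-beyond (suc i) (s≤s nR≤i) = toFin?-≥ i nR≤i

  first : List (Node F) → Red → Maybe ℕ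
  first ts x = firstPosition (x ∈̂?_) ts

  guard : List (Node F) → ℕ → Maybe ℕ
  guard ts i = vertex i >>= first ts

  labelled : List (Node F) → ℕ → Maybe Red
  labelled ts i = guard ts i >>= λ _ → vertex i

  guard-label : ∀ ts x → guard ts (label x) ≡ first ts x
  guard-label ts x rewrite vertex-label x = refl

  guard-bounds : ∀ ts i {j} → guard ts i ≡ just j → 1 ≤ j × j ≤ length ts
  guard-bounds ts i eq with >>=-just (vertex i) eq
  ... | x , _ , first≡ with firstPosition-sound (x ∈̂?_) ts first≡
  ... | _ , nth≡ , _ = nth-bounds ts _ nth≡

  labelled-just : ∀ ts i {x} → labelled ts i ≡ just x → label x ≡ i × ∃[ j ] first ts x ≡ just j
  labelled-just ts i eq with >>=-just (guard ts i) eq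
  ... | j , guard≡ , vertex≡ with >>=-just (vertex i) guard≡
  ... | _ , vertex≡' , first≡ rewrite just-injective (trans (sym vertex≡') vertex≡) =
    vertex-just i vertex≡ , j , first≡

  labelled-label : ∀ ts x {j} → first ts x ≡ just j → labelled ts (label x) ≡ just x
  labelled-label ts x first≡ rewrite guard-label ts x | first≡ = vertex-label x

  is-just-guard : ∀ ts i → (is-just (guard ts i) ≡ true) ⇔ InLabels J F Γ ts i
  is-just-guard ts i = mk⇔ to from
    where
      to : is-just (guard ts i) ≡ true → InLabels J F Γ ts i
      to isJust with _ , guard≡ ← is-just⇒just (guard ts i) isJust
        with x , vertex≡ , first≡ ← >>=-just (vertex i) guard≡
        with t , nth≡ , x∈̂t ← firstPosition-sound (x ∈̂?_) ts first≡
        = x , vertex-just i vertex≡ , t , nth⇒∈ ts _ nth≡ , x∈̂t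
      from : InLabels J F Γ ts i → is-just (guard ts i) ≡ true
      from (x , refl , t , t∈ts , x∈̂t) with _ , first≡ ← firstPosition-complete (x ∈̂?_) ts t∈ts x∈̂t =
        cong is-just (trans (guard-label ts x) first≡)

  guard-isMinIndex : ∀ ts i {j} → guard ts i ≡ just j → IsMinIndex J F Γ ts i j
  guard-isMinIndex ts i guard≡
    with x , vertex≡ , first≡ ← >>=-just (vertex i) guard≡
    with t , nth≡ , x∈̂t ← firstPosition-sound (x ∈̂?_) ts first≡
    with 1≤j , j≤len ← nth-bounds ts _ nth≡
    = x , vertex-just i vertex≡ , 1≤j , j≤len , (t , nth≡ , x∈̂t) ,
      λ _ _ nth'≡ x∈̂t' → firstPosition-least (x ∈̂?_) ts first≡ nth'≡ x∈̂t'

  is-just-labelled : ∀ ts i → is-just (labelled ts i) ≡ is-just (guard ts i)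
  is-just-labelled ts i with vertex i
  ... | nothing = refl
  ... | just x with first ts x
  ...   | nothing = refl
  ...   | just _ = refl

  New : List (Node F) → List (Node F) → Pred Red 0ℓ
  New ts ys x = is-just (first (ts ++ ys) x) ≡ true × is-just (first ts x) ≡ false

  newLabels : List (Node F) → List (Node F) → List ℕ
  newLabels ts ys = map label (filter New? (allFin _))
    where
      New? : Decidable (New ts ys)
      New? x = (is-just (first (ts ++ ys) x) Bool.≟ true) ×-dec (is-just (first ts x) Bool.≟ false)

  newLabels-sound : ∀ ts ys {i} → i ∈ newLabels ts ys → ∃[ x ] label x ≡ i × New ts ys x
  newLabels-sound ts ys i∈ with ∈-map⁻ label i∈
  ... | x , x∈ , refl = x , refl , proj₂ (∈-filter⁻ _ {xs = allFin _} x∈)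

  newLabels-complete : ∀ ts ys {x} → New ts ys x → label x ∈ newLabels ts ys
  newLabels-complete ts ys new = ∈-map⁺ label (∈-filter⁺ _ (∈-allFin _) new)

  guard-++ : ∀ ts ys i → i ∉ newLabels ts ys → guard ts i ≡ guard (ts ++ ys) i
  guard-++ ts ys i i∉ with vertex i in vertex≡
  ... | nothing = refl
  ... | just x with first ts x in first≡
  ...   | just j = sym (firstPosition-++ (x ∈̂?_) ts ys first≡)
  ...   | nothing with first (ts ++ ys) x in first++≡
  ...     | nothing = refl
  ...     | just _ = ⊥-elim (i∉ (subst (_∈ newLabels ts ys) (vertex-just i vertex≡)
                                  (newLabels-complete ts ys (cong is-just first++≡ , cong is-just first≡))))

  module Induced {S : Pred (Node F) 0ℓ} (S? : Decidable S) where
    open ≡-Reasoning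

    Reached : Pred Red 0ℓ
    Reached x = ∃[ t ] S t × x ∈̂ t

    module R = Enumeration {P = Reached} (λ x → any? λ t → S? t ×-dec x ∈̂? t)
    module B = Enumeration S?

    red : List (Node F) → ℕ → Maybe (Fin R.size)
    red ts i = labelled ts i >>= R.index?

    blue : List (Node F) → ℕ → Maybe (Fin B.size)
    blue ts j = nth ts j >>= B.index?

    module _ {ts : List (Node F)} (ts⊆S : (_∈ ts) ⊆ S) where

      labelled-reached : ∀ i {x} → labelled ts i ≡ just x → Reached x
      labelled-reached i eq with labelled-just ts i eq
      ... | _ , _ , first≡ with firstPosition-sound (_ ∈̂?_) ts first≡
      ... | t , nth≡ , x∈̂t = t , ts⊆S (nth⇒∈ ts _ nth≡) , x∈̂t

      map-enc-red : ∀ i → Maybe.map R.enc (red ts i) ≡ labelled ts i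
      map-enc-red i = R.map-enc-bind-index? (labelled ts i) (labelled-reached i)

      map-enc-blue : ∀ j → Maybe.map B.enc (blue ts j) ≡ nth ts j
      map-enc-blue j = B.map-enc-bind-index? (nth ts j) (λ eq → ts⊆S (nth⇒∈ ts j eq))

      is-just-red : ∀ i → is-just (red ts i) ≡ is-just (guard ts i)
      is-just-red i = begin
        is-just (red ts i)                   ≡⟨ sym (is-just-map R.enc (red ts i)) ⟩
        is-just (Maybe.map R.enc (red ts i)) ≡⟨ cong is-just (map-enc-red i) ⟩
        is-just (labelled ts i)              ≡⟨ is-just-labelled ts i ⟩
        is-just (guard ts i)                 ∎

      is-just-blue : ∀ j → is-just (blue ts j) ≡ is-just (nth ts j)
      is-just-blue j = trans (sym (is-just-map B.enc (blue ts j))) (cong is-just (map-enc-blue j))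

    red-label : ∀ ts i {y} → red ts i ≡ just y → label (R.enc y) ≡ i
    red-label ts i eq = proj₁ (labelled-just ts i (R.bind-index?-just (labelled ts i) eq))

    red-of-first : ∀ ts y {j} → first ts (R.enc y) ≡ just j → red ts (label (R.enc y)) ≡ just y
    red-of-first ts y first≡ = R.bind-index?-enc (labelled-label ts (R.enc y) first≡)

    blue-of-nth : ∀ ts j {e} → nth ts j ≡ just (B.enc e) → blue ts j ≡ just e
    blue-of-nth ts j = B.bind-index?-enc

    induced : (bts rts : List (Node F)) → (_∈ rts) ⊆ S →
              length bts ≤ k → length rts ≤ k → LIG k
    induced bts rts rts⊆S bts≤k rts≤k = record
      { nR = R.size
      ; nB = B.size
      ; E = λ e v → IG.E J (Γ (B.enc e)) (R.enc v)
      ; hasNb = hasNb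
      ; r = red rts
      ; b = blue bts
      ; g = guard rts
      ; r-pos = refl
      ; r-fin = suc (IG.nR J) , λ i nR<i → >>=-nothing (>>=-nothing (>>=-nothing (vertex-beyond i nR<i)))
      ; b-dom = λ j e eq → ≤k {bts} bts≤k (nth-bounds bts j (B.bind-index?-just (nth bts j) eq))
      ; g-dom = λ i → sym (is-just-red rts⊆S i)
      ; g-rng = λ i j eq → ≤k {rts} rts≤k (guard-bounds rts i eq)
      }
      where
        hasNb : ∀ v → ∃[ e ] IG.E J (Γ (B.enc e)) (R.enc v) ≡ true
        hasNb v with R.enc-sat v
        ... | t , St , x∈̂t = B.index t St , subst (λ t → R.enc v ∈̂ t) (sym (B.enc-index t St)) x∈̂t

        ≤k : ∀ {ts : List (Node F)} {j} → length ts ≤ k → 1 ≤ j × j ≤ length ts → 1 ≤ j × j ≤ k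
        ≤k ts≤k (1≤j , j≤) = 1≤j , ≤-trans j≤ ts≤k

    induced-≅ : ∀ {bts rts bts' rts'} {p : (_∈ rts) ⊆ S} {p' : (_∈ rts') ⊆ S}
                  {q q' s s'} → GraphIso (induced bts rts p q s) (induced bts' rts' p' q' s')
    induced-≅ = record
      { φR = id ; φR⁻ = id ; φB = id ; φB⁻ = id
      ; invR₁ = λ _ → refl ; invR₂ = λ _ → refl ; invB₁ = λ _ → refl ; invB₂ = λ _ → refl
      ; edges = λ _ _ → refl }

    induced-GLI⁰ : ∀ ts (ts⊆S : (_∈ ts) ⊆ S) (S⊆ts : S ⊆ (_∈ ts)) (ts≤k : length ts ≤ k) →
                   GLI k 0 (induced ts ts ts⊆S ts≤k ts≤k)
    induced-GLI⁰ ts ts⊆S S⊆ts ts≤k = base realGuards (redLabelled , blueLabelled)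
      where
        L = induced ts ts ts⊆S ts≤k ts≤k

        realGuards : RealGuards L
        realGuards i y j red≡ guard≡
          with labelled≡ ← R.bind-index?-just (labelled ts i) red≡
          with t , nth≡ , y∈̂t ← firstPosition-sound (_ ∈̂?_) ts (begin
                 first ts (R.enc y)         ≡⟨ guard-label ts (R.enc y) ⟨
                 guard ts (label (R.enc y)) ≡⟨ cong (guard ts) (proj₁ (labelled-just ts i labelled≡)) ⟩
                 guard ts i                 ≡⟨ guard≡ ⟩
                 just j                     ∎)
          = B.index t St , blue-of-nth ts j (trans nth≡ (cong just (sym (B.enc-index t St))))
          , subst (λ t → R.enc y ∈̂ t) (sym (B.enc-index t St)) y∈̂t
          where St = ts⊆S (nth⇒∈ ts j nth≡)

        redLabelled : ∀ y → ∃[ i ] red ts i ≡ just y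
        redLabelled y with R.enc-sat y
        ... | t , St , y∈̂t with firstPosition-complete (_ ∈̂?_) ts (S⊆ts St) y∈̂t
        ... | _ , first≡ = label (R.enc y) , red-of-first ts y first≡

        blueLabelled : ∀ e → ∃[ j ] blue ts j ≡ just e
        blueLabelled e with ∈⇒nth ts (S⊆ts (B.enc-sat e))
        ... | j , nth≡ = j , blue-of-nth ts j nth≡

    induced-dropNewRed : ∀ {i} bts ts ys {p : (_∈ ts ++ ys) ⊆ S} {q : (_∈ ts) ⊆ S} {bts≤k rts≤k rts≤k'} →
                         GLI k i (induced bts (ts ++ ys) p bts≤k rts≤k) →
                         GLI k i (induced bts ts q bts≤k rts≤k')
    induced-dropNewRed bts ts ys {p} {q} gli =
      remRed (newLabels ts ys) gli newGuarded
        (induced-≅ {bts = bts} {bts' = bts} {p = p} {p' = q} , redLabels , λ _ → sym (map-id _))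
      where
        newGuarded : ∀ i → i ∈ newLabels ts ys → is-just (red (ts ++ ys) i) ≡ true
        newGuarded i i∈ with newLabels-sound ts ys i∈
        ... | x , refl , guarded , _ =
          trans (is-just-red p (label x)) (trans (cong is-just (guard-label (ts ++ ys) x)) guarded)

        redLabels : ∀ i → (i ∈ newLabels ts ys → red ts i ≡ nothing × guard ts i ≡ nothing) ×
                          (i ∉ newLabels ts ys → red ts i ≡ Maybe.map id (red (ts ++ ys) i) ×
                                                  guard ts i ≡ guard (ts ++ ys) i)
        redLabels i = removed , kept
          where
            removed : i ∈ newLabels ts ys → red ts i ≡ nothing × guard ts i ≡ nothing
            removed i∈ with newLabels-sound ts ys i∈
            ... | x , refl , _ , unguarded
              with guard≡ ← trans (guard-label ts x) (is-just≡false unguarded)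
              = >>=-nothing (>>=-nothing guard≡) , guard≡

            kept : i ∉ newLabels ts ys →
                   red ts i ≡ Maybe.map id (red (ts ++ ys) i) × guard ts i ≡ guard (ts ++ ys) i
            kept i∉ with guard≡ ← guard-++ ts ys i i∉ =
              trans (cong (λ m → (m >>= λ _ → vertex i) >>= R.index?) guard≡) (sym (map-id _)) , guard≡

    induced-dropLastBlue : ∀ {i} ts c → S c → ∀ {p : (_∈ ts) ⊆ S} {bts≤k bts≤k' rts≤k} →
                           GLI k i (induced (ts ∷ʳ c) ts p bts≤k rts≤k) →
                           GLI k (i + 1) (induced ts ts p bts≤k' rts≤k)
    induced-dropLastBlue ts c Sc {p} gli =
      remBlue last gli (All.[] ∷ []) lastUnguarded
        (induced-≅ {bts = ts ∷ʳ c} {bts' = ts} {p = p} {p' = p} , (λ _ → sym (map-id _) , refl) , blueLabels)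
      where
        last = suc (length ts) ∷ []

        lastUnguarded : ∀ j → j ∈ last → is-just (blue (ts ∷ʳ c) j) ≡ true × ¬ (∃[ i ] guard ts i ≡ just j)
        lastUnguarded _ (here refl) =
          cong is-just (blue-of-nth (ts ∷ʳ c) _ (trans (nth-∷ʳ-last ts c) (cong just (sym (B.enc-index c Sc))))) ,
          λ (i , guard≡) → <-irrefl refl (proj₂ (guard-bounds ts i guard≡))

        blueLabels : ∀ j → (j ∈ last → blue ts j ≡ nothing) ×
                           (j ∉ last → blue ts j ≡ Maybe.map id (blue (ts ∷ʳ c) j))
        blueLabels j =
          (λ { (here refl) → >>=-nothing (nth-beyond ts _ ≤-refl) }) ,
          λ j∉ → trans (cong (_>>= B.index?) (sym (nth-∷ʳ ts c j (λ eq → j∉ (here eq))))) (sym (map-id _))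

  open Induced public using (induced; red; blue; induced-GLI⁰; induced-dropNewRed; induced-dropLastBlue)

  module Glue {A B L : Pred (Node F) 0ℓ} (A? : Decidable A) (B? : Decidable B) (L? : Decidable L)
              (A⊆L : A ⊆ L) (B⊆L : B ⊆ L) (L⊆A∪B : L ⊆ A ∪ B)
              (ts : List (Node F)) (ts≤k : length ts ≤ k)
              (ts⊆A : (_∈ ts) ⊆ A) (ts⊆B : (_∈ ts) ⊆ B) (ts⊆L : (_∈ ts) ⊆ L)
              (blue-overlap : ∀ {t} → A t → B t → t ∈ ts)
              (red-overlap : ∀ {s t x} → A s → B t → x ∈̂ s → x ∈̂ t → ∃[ p ] p ∈ ts × x ∈̂ p) where
    open ≡-Reasoning
    private
      module IL = Induced L?

    module Embed {X : Pred (Node F) 0ℓ} (X? : Decidable X) (X⊆L : X ⊆ L) where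
      module IX = Induced X?

      reached⊆ : IX.Reached ⊆ IL.Reached
      reached⊆ (t , Xt , x∈̂t) = t , X⊆L Xt , x∈̂t

      ρ : Fin IX.R.size → Fin IL.R.size
      ρ v = IL.R.index (IX.R.enc v) (reached⊆ (IX.R.enc-sat v))

      σ : Fin IX.B.size → Fin IL.B.size
      σ e = IL.B.index (IX.B.enc e) (X⊆L (IX.B.enc-sat e))

      enc-ρ : ∀ v → IL.R.enc (ρ v) ≡ IX.R.enc v
      enc-ρ v = IL.R.enc-index _ _

      enc-σ : ∀ e → IL.B.enc (σ e) ≡ IX.B.enc e
      enc-σ e = IL.B.enc-index _ _

      ρ-injective : Injective _≡_ _≡_ ρ
      ρ-injective {v} {w} eq = IX.R.enc-injective (trans (sym (enc-ρ v)) (trans (cong IL.R.enc eq) (enc-ρ w)))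

      σ-injective : Injective _≡_ _≡_ σ
      σ-injective {e} {f} eq = IX.B.enc-injective (trans (sym (enc-σ e)) (trans (cong IL.B.enc eq) (enc-σ f)))

      ρ-reached : ∀ v → ∃[ t ] X t × IL.R.enc (ρ v) ∈̂ t
      ρ-reached v = let t , Xt , v∈̂t = IX.R.enc-sat v in t , Xt , subst (_∈̂ t) (sym (enc-ρ v)) v∈̂t

      σ-in : ∀ e → X (IL.B.enc (σ e))
      σ-in e = subst X (sym (enc-σ e)) (IX.B.enc-sat e)

      ρ-onto : ∀ v {t} → X t → IL.R.enc v ∈̂ t → ∃[ v' ] ρ v' ≡ v
      ρ-onto v Xt v∈̂t = v' , IL.R.enc-injective (trans (enc-ρ v') (IX.R.enc-index _ _))
        where v' = IX.R.index (IL.R.enc v) (_ , Xt , v∈̂t)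

      σ-onto : ∀ e → X (IL.B.enc e) → ∃[ e' ] σ e' ≡ e
      σ-onto e Xe = e' , IL.B.enc-injective (trans (enc-σ e') (IX.B.enc-index _ _))
        where e' = IX.B.index (IL.B.enc e) Xe

      edge-σρ : ∀ e v → IG.E J (Γ (IL.B.enc (σ e))) (IL.R.enc (ρ v)) ≡ IG.E J (Γ (IX.B.enc e)) (IX.R.enc v)
      edge-σρ e v rewrite enc-σ e | enc-ρ v = refl

      edge-lift : ∀ e v → X (IL.B.enc e) → IG.E J (Γ (IL.B.enc e)) (IL.R.enc v) ≡ true →
                  ∃[ e' ] ∃[ v' ] σ e' ≡ e × ρ v' ≡ v × IG.E J (Γ (IX.B.enc e')) (IX.R.enc v') ≡ true
      edge-lift e v Xe v∈̂e with e' , refl ← σ-onto e Xe with v' , refl ← ρ-onto v Xe v∈̂e =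
        e' , v' , refl , refl , trans (sym (edge-σρ e' v')) v∈̂e

      ρ-red : ∀ j {v} → IX.red ts j ≡ just v → labelled ts j ≡ just (IL.R.enc (ρ v))
      ρ-red j {v} eq = trans (IX.R.bind-index?-just (labelled ts j) eq) (cong just (sym (enc-ρ v)))

      red-ρ : ∀ v {j} → first ts (IL.R.enc (ρ v)) ≡ just j → IX.red ts (label (IL.R.enc (ρ v))) ≡ just v
      red-ρ v rewrite enc-ρ v = IX.red-of-first ts v

      σ-blue : ∀ j {e} → IX.blue ts j ≡ just e → nth ts j ≡ just (IL.B.enc (σ e))
      σ-blue j {e} eq = trans (IX.B.bind-index?-just (nth ts j) eq) (cong just (sym (enc-σ e)))

      blue-σ : ∀ e {j} → nth ts j ≡ just (IL.B.enc (σ e)) → IX.blue ts j ≡ just e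
      blue-σ e rewrite enc-σ e = IX.blue-of-nth ts _

      map-ρ-red : (_∈ ts) ⊆ X → ∀ i → Maybe.map IL.R.enc (Maybe.map ρ (IX.red ts i)) ≡ labelled ts i
      map-ρ-red ts⊆X i = begin
        Maybe.map IL.R.enc (Maybe.map ρ (IX.red ts i)) ≡⟨ map-∘ (IX.red ts i) ⟨
        Maybe.map (IL.R.enc ∘ ρ) (IX.red ts i)         ≡⟨ map-cong enc-ρ (IX.red ts i) ⟩
        Maybe.map IX.R.enc (IX.red ts i)               ≡⟨ IX.map-enc-red ts⊆X i ⟩
        labelled ts i                                  ∎

      map-σ-blue : (_∈ ts) ⊆ X → ∀ j → Maybe.map IL.B.enc (Maybe.map σ (IX.blue ts j)) ≡ nth ts j
      map-σ-blue ts⊆X j = begin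
        Maybe.map IL.B.enc (Maybe.map σ (IX.blue ts j)) ≡⟨ map-∘ (IX.blue ts j) ⟨
        Maybe.map (IL.B.enc ∘ σ) (IX.blue ts j)         ≡⟨ map-cong enc-σ (IX.blue ts j) ⟩
        Maybe.map IX.B.enc (IX.blue ts j)               ≡⟨ IX.map-enc-blue ts⊆X j ⟩
        nth ts j                                        ∎

    private
      module EA = Embed A? A⊆L
      module EB = Embed B? B⊆L

      LA = induced A? ts ts ts⊆A ts≤k ts≤k
      LB = induced B? ts ts ts⊆B ts≤k ts≤k
      LL = induced L? ts ts ts⊆L ts≤k ts≤k

      ρ-surj : ∀ v → ∃[ u ] [ EA.ρ , EB.ρ ] u ≡ v
      ρ-surj v with t , Lt , v∈̂t ← IL.R.enc-sat v with L⊆A∪B Lt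
      ... | inj₁ At = let v' , eq = EA.ρ-onto v At v∈̂t in inj₁ v' , eq
      ... | inj₂ Bt = let v' , eq = EB.ρ-onto v Bt v∈̂t in inj₂ v' , eq

      σ-surj : ∀ e → ∃[ u ] [ EA.σ , EB.σ ] u ≡ e
      σ-surj e with L⊆A∪B (IL.B.enc-sat e)
      ... | inj₁ Ae = let e' , eq = EA.σ-onto e Ae in inj₁ e' , eq
      ... | inj₂ Be = let e' , eq = EB.σ-onto e Be in inj₂ e' , eq

      redId-sound : ∀ {u w} → RedId LA LB u w → [ EA.ρ , EB.ρ ] u ≡ [ EA.ρ , EB.ρ ] w
      redId-sound (ident j x y redA redB) =
        IL.R.enc-injective (just-injective (trans (sym (EA.ρ-red j redA)) (EB.ρ-red j redB)))

      redId-complete : ∀ {x y} → EA.ρ x ≡ EB.ρ y → RedId LA LB (inj₁ x) (inj₂ y)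
      redId-complete {x} {y} eq
        with s , As , x∈̂s ← EA.ρ-reached x
        with t , Bt , y∈̂t ← EB.ρ-reached y
        with p , p∈ts , x∈̂p ← red-overlap As Bt x∈̂s (subst (λ w → IL.R.enc w ∈̂ t) (sym eq) y∈̂t)
        with j , first≡ ← firstPosition-complete (_ ∈̂?_) ts p∈ts x∈̂p
        = ident (label (IL.R.enc (EA.ρ x))) x y (EA.red-ρ x first≡)
                      (subst (λ w → EB.IX.red ts (label (IL.R.enc w)) ≡ just y) (sym eq)
                             (EB.red-ρ y (subst (λ w → first ts (IL.R.enc w) ≡ just j) eq first≡)))

      blueId-sound : ∀ {u w} → BlueId LA LB u w → [ EA.σ , EB.σ ] u ≡ [ EA.σ , EB.σ ] w
      blueId-sound (ident j x y blueA blueB) =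
        IL.B.enc-injective (just-injective (trans (sym (EA.σ-blue j blueA)) (EB.σ-blue j blueB)))

      blueId-complete : ∀ {x y} → EA.σ x ≡ EB.σ y → BlueId LA LB (inj₁ x) (inj₂ y)
      blueId-complete {x} {y} eq
        with j , nth≡ ← ∈⇒nth ts (blue-overlap (EA.σ-in x) (subst (λ e → B (IL.B.enc e)) (sym eq) (EB.σ-in y)))
        = ident j x y (EA.blue-σ x nth≡) (EB.blue-σ y (subst (λ e → nth ts j ≡ just (IL.B.enc e)) eq nth≡))

      EdgePreimage : Fin IL.B.size → Fin IL.R.size → Set
      EdgePreimage e v =
        (∃[ e₁ ] ∃[ v₁ ] EA.σ e₁ ≡ e × EA.ρ v₁ ≡ v × EA.IX.R.enc v₁ ∈̂ EA.IX.B.enc e₁) ⊎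
        (∃[ e₂ ] ∃[ v₂ ] EB.σ e₂ ≡ e × EB.ρ v₂ ≡ v × EB.IX.R.enc v₂ ∈̂ EB.IX.B.enc e₂)

      edges : ∀ e v → (IL.R.enc v ∈̂ IL.B.enc e) ⇔ EdgePreimage e v
      edges e v = mk⇔ lift project
        where
          lift : IL.R.enc v ∈̂ IL.B.enc e → EdgePreimage e v
          lift v∈̂e with L⊆A∪B (IL.B.enc-sat e)
          ... | inj₁ Ae = inj₁ (EA.edge-lift e v Ae v∈̂e)
          ... | inj₂ Be = inj₂ (EB.edge-lift e v Be v∈̂e)
          project : EdgePreimage e v → IL.R.enc v ∈̂ IL.B.enc e
          project (inj₁ (e₁ , v₁ , refl , refl , v∈̂e)) = trans (EA.edge-σρ e₁ v₁) v∈̂e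
          project (inj₂ (e₂ , v₂ , refl , refl , v∈̂e)) = trans (EB.edge-σρ e₂ v₂) v∈̂e

      r-glue : ∀ i → red L? ts i ≡ (Maybe.map EA.ρ (red A? ts i) <∣> Maybe.map EB.ρ (red B? ts i))
      r-glue i = map-injective IL.R.enc-injective (begin
        Maybe.map IL.R.enc (red L? ts i)                   ≡⟨ IL.map-enc-red ts⊆L i ⟩
        labelled ts i                                      ≡⟨ <∣>-idem (labelled ts i) ⟨
        labelled ts i <∣> labelled ts i                    ≡⟨ cong₂ _<∣>_ (EA.map-ρ-red ts⊆A i)
                                                                          (EB.map-ρ-red ts⊆B i) ⟨
        Maybe.map IL.R.enc ρA <∣> Maybe.map IL.R.enc ρB    ≡⟨ map-<∣> IL.R.enc ρA ρB ⟨
        Maybe.map IL.R.enc (ρA <∣> ρB)                     ∎)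
        where
          ρA = Maybe.map EA.ρ (red A? ts i)
          ρB = Maybe.map EB.ρ (red B? ts i)

      b-glue : ∀ j → blue L? ts j ≡ (Maybe.map EA.σ (blue A? ts j) <∣> Maybe.map EB.σ (blue B? ts j))
      b-glue j = map-injective IL.B.enc-injective (begin
        Maybe.map IL.B.enc (blue L? ts j)                  ≡⟨ IL.map-enc-blue ts⊆L j ⟩
        nth ts j                                           ≡⟨ <∣>-idem (nth ts j) ⟨
        nth ts j <∣> nth ts j                              ≡⟨ cong₂ _<∣>_ (EA.map-σ-blue ts⊆A j)
                                                                          (EB.map-σ-blue ts⊆B j) ⟨
        Maybe.map IL.B.enc σA <∣> Maybe.map IL.B.enc σB    ≡⟨ map-<∣> IL.B.enc σA σB ⟨
        Maybe.map IL.B.enc (σA <∣> σB)                     ∎)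
        where
          σA = Maybe.map EA.σ (blue A? ts j)
          σB = Maybe.map EB.σ (blue B? ts j)

    induced-isGlue : IsGlue LA LB LL
    induced-isGlue = record
      { ρ₁ = EA.ρ ; ρ₂ = EB.ρ ; σ₁ = EA.σ ; σ₂ = EB.σ
      ; ρ-surj = ρ-surj ; σ-surj = σ-surj
      ; ρ-ker = [,]-≡⇔EqClosure EA.ρ-injective EB.ρ-injective redId-sound redId-complete
      ; σ-ker = [,]-≡⇔EqClosure EA.σ-injective EB.σ-injective blueId-sound blueId-complete
      ; edges = edges
      ; r-glue = r-glue
      ; b-glue = b-glue
      ; g-glue = λ i → sym (<∣>-idem (guard ts i)) }

    induced-glue : ∀ {i j} → GLI k i LA → GLI k j LB → GLI k (i ⊔ j) LL
    induced-glue gA gB = glue gA gB (λ _ _ _ eq₁ eq₂ → just-injective (trans (sym eq₁) eq₂)) induced-isGlue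

-- The recursion along the elimination tree

module Recursion (k : ℕ) (J : IG) (F : Forest) (Γ : Node F → Fin (IG.nB J))
                 (elim : StrictElimForest J F Γ) (height : HeightAtMost F k) where
  open Forest F using (parent)
  open ForestProperties F
  open Construction k J F Γ

  -- Stem n (children n) is the node set of the subtree with stem Ṫ_n.
  Stem : Node F → List (Node F) → Pred (Node F) 0ℓ
  Stem n cs t = t ≤T n ⊎ Any (_≤T t) cs

  Stem? : ∀ n cs → Decidable (Stem n cs)
  Stem? n cs t = (t ≤T? n) ⊎-dec Any.any? (_≤T? t) cs

  path⊆Stem : ∀ {n ts cs t} → RootPath F n ts → t ∈ ts → Stem n cs t
  path⊆Stem rp t∈ts = inj₁ (path-≤T rp t∈ts)

  children : Node F → List (Node F)
  children n = filter (λ c → ≡-dec _≟_ (parent c) (just n)) (allFin _)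

  children-parent : ∀ {n c} → c ∈ children n → parent c ≡ just n
  children-parent c∈ = proj₂ (∈-filter⁻ _ {xs = allFin _} c∈)

  parent-children : ∀ {n c} → parent c ≡ just n → c ∈ children n
  parent-children pc = ∈-filter⁺ _ (∈-allFin _) pc

  Stem-children⇒InStem : ∀ {n t} → Stem n (children n) t → InStem F n t
  Stem-children⇒InStem (inj₁ t≤n) = inj₁ t≤n
  Stem-children⇒InStem (inj₂ below) = let c , c∈ , c≤t = find below in
    inj₂ (≤T-trans (parent-≤T (children-parent c∈)) c≤t)

  InStem⇒Stem-children : ∀ {n t} → InStem F n t → Stem n (children n) t
  InStem⇒Stem-children (inj₁ t≤n) = inj₁ t≤n
  InStem⇒Stem-children (inj₂ n≤t) with ≤T-step n≤t
  ... | inj₁ refl = inj₁ here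
  ... | inj₂ (c , pc , c≤t) = inj₂ (lose (parent-children pc) c≤t)

  partialStemGraph : ∀ {n ts} → RootPath F n ts → List (Node F) → LIG k
  partialStemGraph {n} {ts} rp cs = induced (Stem? n cs) ts ts (path⊆Stem rp) (height n ts rp) (height n ts rp)

  stemGraph : ∀ n ts → RootPath F n ts → LIG k
  stemGraph n ts rp = partialStemGraph rp (children n)

  module Siblings {n c : Node F} {cs : List (Node F)} (pc : parent c ≡ just n)
                  (cs-children : ∀ {c'} → c' ∈ cs → parent c' ≡ just n) (c∉cs : c ∉ cs) where

    distinct : ∀ {c'} → c' ∈ cs → c ≢ c'
    distinct c'∈ refl = c∉cs c'∈

    below-or-within : ∀ {t} → InStem F c t → t ≤T n ⊎ c ≤T t
    below-or-within (inj₁ t≤c) with below-child pc t≤c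
    ... | inj₁ refl = inj₂ here
    ... | inj₂ t≤n = inj₁ t≤n
    below-or-within (inj₂ c≤t) = inj₂ c≤t

    blue-overlap : ∀ {t} → Stem n cs t → InStem F c t → t ≤T n
    blue-overlap (inj₁ t≤n) _ = t≤n
    blue-overlap (inj₂ below) t∈Ṫc with c' , c'∈ , c'≤t ← find below with below-or-within t∈Ṫc
    ... | inj₁ t≤n = t≤n
    ... | inj₂ c≤t = ⊥-elim (distinct c'∈ (children-disjoint pc (cs-children c'∈) c≤t c'≤t))

    lcv-≤T : ∀ {c' s t l} → c' ∈ cs → c' ≤T s → c ≤T t → IsLcv F s t l → l ≤T n
    lcv-≤T c'∈ c'≤s c≤t (l≤s , l≤t , greatest)
      with ≤T-step (greatest _ (≤T-trans (parent-≤T (cs-children c'∈)) c'≤s) (≤T-trans (parent-≤T pc) c≤t))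
    ... | inj₁ refl = here
    ... | inj₂ (c'' , pc'' , c''≤l) = ⊥-elim (distinct c'∈ (trans
          (sym (children-disjoint pc'' pc (≤T-trans c''≤l l≤t) c≤t))
          (children-disjoint pc'' (cs-children c'∈) (≤T-trans c''≤l l≤s) c'≤s)))

    -- by strictness a shared red vertex is incident to an ancestor of the lcv, which lies on P(n)
    red-overlap : ∀ {s t x} → Stem n cs s → InStem F c t → x ∈̂ s → x ∈̂ t → ∃[ p ] p ≤T n × x ∈̂ p
    red-overlap (inj₁ s≤n) _ x∈̂s _ = _ , s≤n , x∈̂s
    red-overlap {s} {t} {x} (inj₂ below) t∈Ṫc x∈̂s x∈̂t with c' , c'∈ , c'≤s ← find below with below-or-within t∈Ṫc
    ... | inj₁ t≤n = _ , t≤n , x∈̂t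
    ... | inj₂ c≤t with l , lcv , p , p≤l , x∈̂p ← proj₂ elim s t x x∈̂s x∈̂t =
      p , ≤T-trans p≤l (lcv-≤T c'∈ c'≤s c≤t lcv) , x∈̂p

  GLI-up : ∀ m {L} → GLI k 0 L → GLI k m L
  GLI-up zero gli = gli
  GLI-up (suc m) gli = up (GLI-up m gli)

  foldChildren : ∀ {n ts} (rp : RootPath F n ts) m cs → Unique cs →
                 (cs-children : ∀ {c} → c ∈ cs → parent c ≡ just n) →
                 (∀ {c} (c∈ : c ∈ cs) →
                    ∃[ m' ] suc m' ≡ m × GLI k m' (stemGraph c (ts ∷ʳ c) (step (cs-children c∈) rp))) →
                 GLI k m (partialStemGraph rp cs)
  foldChildren {n} {ts} rp m [] _ _ _ =
    GLI-up m (induced-GLI⁰ (Stem? n []) ts (path⊆Stem rp) (λ { (inj₁ t≤n) → ≤T-path rp t≤n }) (height n ts rp))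
  foldChildren {n} {ts} rp m (c ∷ cs) (c≢cs ∷ cs!) cs-children sub with m' , refl , gc ← sub (here refl) =
    subst (λ i → GLI k i (partialStemGraph rp (c ∷ cs)))
          (trans (cong (suc m' ⊔_) (+-comm m' 1)) (⊔-idem (suc m')))
      (Glue.induced-glue (Stem? n cs) (Stem? c (children c)) (Stem? n (c ∷ cs)) A⊆L B⊆L L⊆A∪B
                         ts (height n ts rp) (path⊆Stem rp) ts⊆B (path⊆Stem rp) blue-overlap red-overlap
                         (foldChildren rp (suc m') cs cs! (λ c∈ → cs-children (there c∈)) (λ c∈ → sub (there c∈)))
                         trimmed)
    where
      pc : parent c ≡ just n
      pc = cs-children (here refl)

      open Siblings pc (λ c∈ → cs-children (there c∈)) (λ c∈ → All.lookup c≢cs c∈ refl)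
        renaming (blue-overlap to blue-overlap≤; red-overlap to red-overlap≤)

      ts⊆B : (_∈ ts) ⊆ Stem c (children c)
      ts⊆B t∈ = path⊆Stem (step pc rp) (∈-++⁺ˡ t∈)

      trimmed : GLI k (m' + 1) (induced (Stem? c (children c)) ts ts ts⊆B (height n ts rp) (height n ts rp))
      trimmed = induced-dropLastBlue (Stem? c (children c)) ts c (inj₁ here) {p = ts⊆B}
                  (induced-dropNewRed (Stem? c (children c)) (ts ∷ʳ c) ts (c ∷ [])
                    {p = path⊆Stem (step pc rp)} {q = ts⊆B} gc)

      A⊆L : Stem n cs ⊆ Stem n (c ∷ cs)
      A⊆L (inj₁ t≤n) = inj₁ t≤n
      A⊆L (inj₂ below) = inj₂ (there below)

      B⊆L : Stem c (children c) ⊆ Stem n (c ∷ cs)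
      B⊆L t∈B with below-or-within (Stem-children⇒InStem t∈B)
      ... | inj₁ t≤n = inj₁ t≤n
      ... | inj₂ c≤t = inj₂ (here c≤t)

      L⊆A∪B : Stem n (c ∷ cs) ⊆ Stem n cs ∪ Stem c (children c)
      L⊆A∪B (inj₁ t≤n) = inj₁ (inj₁ t≤n)
      L⊆A∪B (inj₂ (here c≤t)) = inj₂ (InStem⇒Stem-children (inj₂ c≤t))
      L⊆A∪B (inj₂ (there below)) = inj₁ (inj₂ below)

      blue-overlap : ∀ {t} → Stem n cs t → Stem c (children c) t → t ∈ ts
      blue-overlap t∈A t∈B = ≤T-path rp (blue-overlap≤ t∈A (Stem-children⇒InStem t∈B))

      red-overlap : ∀ {s t x} → Stem n cs s → Stem c (children c) t → x ∈̂ s → x ∈̂ t → ∃[ p ] p ∈ ts × x ∈̂ p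
      red-overlap s∈A t∈B x∈̂s x∈̂t
        with p , p≤n , x∈̂p ← red-overlap≤ s∈A (Stem-children⇒InStem t∈B) x∈̂s x∈̂t =
        p , ≤T-path rp p≤n , x∈̂p

  stemGraph-GLI : ∀ m {n ts} (rp : RootPath F n ts) → k ∸ length ts ≡ m → GLI k m (stemGraph n ts rp)
  stemGraph-GLI m {n} {ts} rp k∸d≡m =
    foldChildren rp m (children n) (filter⁺ _ (allFin⁺ _)) children-parent (child m k∸d≡m)
    where
      child : ∀ m → k ∸ length ts ≡ m → ∀ {c} (c∈ : c ∈ children n) →
              ∃[ m' ] suc m' ≡ m × GLI k m' (stemGraph c (ts ∷ʳ c) (step (children-parent c∈) rp))
      child zero k∸d≡0 {c} c∈ = ⊥-elim (<-irrefl refl (≤-trans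
        (subst (_≤ k) (length-∷ʳ ts c) (height c _ (step (children-parent c∈) rp))) (m∸n≡0⇒m≤n k∸d≡0)))
      child (suc m) k∸d≡1+m {c} c∈ = m , refl , stemGraph-GLI m (step (children-parent c∈) rp) (begin
        k ∸ length (ts ∷ʳ c)  ≡⟨ cong (k ∸_) (length-∷ʳ ts c) ⟩
        k ∸ suc (length ts)   ≡⟨ pred[m∸n]≡m∸[1+n] k (length ts) ⟨
        pred (k ∸ length ts)  ≡⟨ cong pred k∸d≡1+m ⟩
        m                     ∎)
        where open ≡-Reasoning

  stemGraph-iso : ∀ {n ts} (rp : RootPath F n ts) → let open Induced (Stem? n (children n)) in
                  IsoToStem J F Γ n (stemGraph n ts rp) R.enc (Γ ∘ B.enc)
  stemGraph-iso {n} rp = record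
    { πR-inj = R.enc-injective
    ; πB-inj = λ eq → B.enc-injective (proj₁ (proj₁ elim) eq)
    ; πR-into = λ v → let t , t∈S , v∈̂t = R.enc-sat v in t , Stem-children⇒InStem t∈S , v∈̂t
    ; πR-onto = λ x t t∈Ṫn x∈̂t → R.index x (t , InStem⇒Stem-children t∈Ṫn , x∈̂t) , R.enc-index _ _
    ; πB-into = λ e → B.enc e , Stem-children⇒InStem (B.enc-sat e) , refl
    ; πB-onto = λ t t∈Ṫn → B.index t (InStem⇒Stem-children t∈Ṫn) , cong Γ (B.enc-index _ _)
    ; edges = λ _ _ → refl }
    where
      open Induced (Stem? n (children n))

lemma4p2 : (k : ℕ) → 1 ≤ k →
    (J : IG) → Connected J → 1 ≤ IG.nR J →
    (F : Forest) (Γ : Node F → Fin (IG.nB J)) → StrictElimForest J F Γ → HeightAtMost F k →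
    (ω : Node F) → IsTreeWithRoot F ω →
    (n : Node F) (ts : List (Node F)) → RootPath F n ts →
    Σ (LIG k) λ L → GLI k (k ∸ length ts) L ×
      (∀ j → (is-just (LIG.b L j) ≡ true) ⇔ (1 ≤ j × j ≤ length ts)) ×
      (∀ i → (is-just (LIG.r L i) ≡ true) ⇔ InLabels J F Γ ts i) ×
      (∀ i j → LIG.g L i ≡ just j → IsMinIndex J F Γ ts i j) ×
      Σ (Fin (LIG.nR L) → Fin (IG.nR J)) λ πR → Σ (Fin (LIG.nB L) → Fin (IG.nB J)) λ πB →
        IsoToStem J F Γ n L πR πB ×
        (∀ i y → LIG.r L i ≡ just y → suc (toℕ (πR y)) ≡ i) ×
        (∀ j e → LIG.b L j ≡ just e → Σ (Node F) λ t → nth ts j ≡ just t × πB e ≡ Γ t)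
lemma4p2 k _ J _ _ F Γ elim height _ _ n ts rp =
  stemGraph n ts rp , stemGraph-GLI (k ∸ length ts) rp refl ,
  (λ j → subst (λ b → (b ≡ true) ⇔ _) (sym (is-just-blue ts⊆S j)) (is-just-nth ts j)) ,
  (λ i → subst (λ b → (b ≡ true) ⇔ _) (sym (is-just-red ts⊆S i)) (is-just-guard ts i)) ,
  (λ i _ → guard-isMinIndex ts i) ,
  R.enc , Γ ∘ B.enc , stemGraph-iso rp ,
  (λ i _ → red-label ts i) ,
  (λ j e eq → B.enc e , B.bind-index?-just (nth ts j) eq , refl)
  where
    open Recursion k J F Γ elim height
    open Construction k J F Γ
    open Induced (Stem? n (children n))

    ts⊆S : (_∈ ts) ⊆ Stem n (children n)
    ts⊆S = path⊆Stem rp
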